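{- Let $b\ge3$ be odd and let $a=a(b,i)$ be the $i$-th input of the complete MDS system. Let $MDS(b,i)=(c_1,\dots,c_{P(b)})$ be the primitive period of $c_j=\mathrm{mod}^*(a2^j,b)$, extended cyclically by $c_{P(b)+l}=c_l$. Let $(q_j)_{j\ge0}$ be the unsigned Schick sequence $q_0=a$, $q_j=|b-2q_{j-1}|$ for $j\ge1$, with primitive period $\mathrm{pes}(b)$. Then $$q_j=b-2\,c_{P(b)-1+j}\qquad\text{for } j=0,1,\dots,\mathrm{pes}(b).$$
   Context: For odd $b\ge3$: - $RRS^*(b)=\{r\in\mathbb Z:1\le r\le(b-1)/2,\ \gcd(r,b)=1\}$. - For $m$ coprime to $b$, $\mathrm{mod}^*(m,b)=\mathrm{mod}(m,b)$ if the least non-negative residue $\mathrm{mod}(m,b)$ is $\le b/2$, and $\mathrm{mod}^*(m,b)=\mathrm{mod}(-m,b)$ otherwise. - MDS inputs: $a(b,1)=1$, and $a(b,i+1)$ is the smallest odd element of $RRS^*(b)$ not occurring in the sequences with earlier inputs. - The sequence $(\mathrm{mod}^*(a2^j,b))_{j\ge1}$ is purely periodic, and its primitive period $P(b)$ equals $\mathrm{pes}(b)$, the primitive period of the Schick sequence. -}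

module Defs where

open import Data.Nat using (ℕ; zero; suc; _+_; _*_; _∸_; _^_; _≤_; _<_; ∣_-_∣)
open import Data.Nat.DivMod using (_%_)
open import Data.Nat.GCD using (gcd)
open import Data.Nat.Properties using (_≤?_)
open import Data.List using (List; []; _∷_; length)
open import Data.List.Relation.Unary.Any using (Any)
open import Data.Product using (Σ; _×_; ∃)
open import Relation.Binary.PropositionalEquality using (_≡_)
open import Relation.Nullary using (¬_; yes; no)

Odd : ℕ → Set
Odd r = r % 2 ≡ 1

-- r ∈ RRS*(b) : 1 ≤ r ≤ (b-1)/2 and gcd(r,b) = 1  (for odd b, r ≤ (b-1)/2 ⇔ 2r < b)
InRRS* : ℕ → ℕ → Set
InRRS* b r = 1 ≤ r × 2 * r < b × gcd r b ≡ 1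

-- mod*(m,b): the least non-negative residue r = mod(m,b) if r ≤ b/2 (i.e. 2r ≤ b),
-- otherwise mod(-m,b) = b - r  (r ≠ 0 in that case).  Junk value 0 for b = 0.
modStar : ℕ → ℕ → ℕ
modStar m zero = 0
modStar m (suc n) with 2 * (m % suc n) ≤? suc n
... | yes _ = m % suc n
... | no  _ = suc n ∸ (m % suc n)

cSeq : ℕ → ℕ → ℕ → ℕ
cSeq b a j = modStar (a * 2 ^ j) b

InOrbit : ℕ → ℕ → ℕ → Set
InOrbit b a r = ∃ λ j → 1 ≤ j × cSeq b a j ≡ r

IsNext : ℕ → List ℕ → ℕ → Set
IsNext b L r =
  Odd r × InRRS* b r × ¬ Any (λ a → InOrbit b a r) L ×
  (∀ r' → Odd r' → InRRS* b r' → ¬ Any (λ a → InOrbit b a r') L → r ≤ r')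

-- Inputs b (a_k ∷ … ∷ a_1 ∷ []) : the list consists of the first k MDS inputs of b,
-- latest input first.
data Inputs (b : ℕ) : List ℕ → Set where
  start : Inputs b (1 ∷ [])
  step  : ∀ {L r} → Inputs b L → IsNext b L r → Inputs b (r ∷ L)

IsMDSInput : ℕ → ℕ → ℕ → Set
IsMDSInput b i a = Σ (List ℕ) λ L → Inputs b (a ∷ L) × suc (length L) ≡ i

schick : ℕ → ℕ → ℕ → ℕ
schick b a zero    = a
schick b a (suc j) = ∣ b - 2 * schick b a j ∣

IsPeriod : (ℕ → ℕ) → ℕ → Set
IsPeriod f p = 1 ≤ p × (∀ j → f (p + j) ≡ f j)

IsPrimitivePeriod : (ℕ → ℕ) → ℕ → Set
IsPrimitivePeriod f p = IsPeriod f p × (∀ p' → IsPeriod f p' → p ≤ p')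

{-# OPTIONS --safe #-}
-- Let fold b r be whichever of r and b − r lies in [0, b/2], so that
-- mod*(m, b) = fold b (m mod b).  As fold identifies exactly r and b − r, the
-- MDS sequence satisfies c (k+1) = fold b (2 c k), and for odd b this step is
-- injective on [0, b/2]: two distinct preimages 2x, 2y would have to sum to b.
-- Periodicity of (c (k+1)) therefore gives c P = c 0 = a, and since a is odd the
-- last step was a reflection, a = b − 2 c (P−1).  As |b − 2 (b − x)| = b − 2 fold b x,
-- the sequences q j and b − 2 c (P−1+j) then obey the same recursion.
module Submission where

open import Defs
open import Data.Nat using (ℕ; zero; suc; _+_; _*_; _∸_; _^_; _≤_; _<_; ∣_-_∣; NonZero)
open import Data.Nat.DivMod
  using (_%_; m*n%n≡0; m<n⇒m%n≡m; m≤n⇒[n∸m]%m≡n%m; %-distribˡ-*; m%n<n; m%n%n≡m%n)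
open import Data.Nat.Properties
open import Data.Integer using (+_; _-_; _⊖_)
open import Data.Product using (_,_)
open import Data.Sum using (_⊎_; inj₁; inj₂)
open import Function using (_∘_)
open import Relation.Nullary using (yes; no; contradiction)
open import Relation.Binary.PropositionalEquality
  using (_≡_; _≢_; refl; sym; trans; cong; cong₂; subst; module ≡-Reasoning)
import Data.Integer.Properties as ℤ

2*n≡n+n : ∀ n → 2 * n ≡ n + n
2*n≡n+n n = cong (_+_ n) (+-identityʳ n)

h+k≡b⇒2h+2k≡b+b : ∀ h k {b} → h + k ≡ b → 2 * h + 2 * k ≡ b + b
h+k≡b⇒2h+2k≡b+b h k {b} h+k≡b = begin
  2 * h + 2 * k ≡⟨ *-distribˡ-+ 2 h k ⟨
  2 * (h + k)   ≡⟨ cong (2 *_) h+k≡b ⟩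
  2 * b         ≡⟨ 2*n≡n+n b ⟩
  b + b         ∎
  where open ≡-Reasoning

odd⇒≢2* : ∀ {b} x → Odd b → b ≢ 2 * x
odd⇒≢2* x odd refl with trans (sym odd) (trans (cong (_% 2) (*-comm 2 x)) (m*n%n≡0 x 2))
... | ()

odd⇒2*< : ∀ {b} x → Odd b → 2 * x ≤ b → 2 * x < b
odd⇒2*< x odd 2x≤b = ≤∧≢⇒< 2x≤b (odd⇒≢2* x odd ∘ sym)

fold : ℕ → ℕ → ℕ
fold b r with 2 * r ≤? b
... | yes _ = r
... | no  _ = b ∸ r

modStar≡fold : ∀ m b .{{_ : NonZero b}} → modStar m b ≡ fold b (m % b)
modStar≡fold m (suc n) with 2 * (m % suc n) ≤? suc n
... | yes _ = refl
... | no  _ = refl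

fold-cases : ∀ b r → fold b r ≡ r ⊎ fold b r ≡ b ∸ r
fold-cases b r with 2 * r ≤? b
... | yes _ = inj₁ refl
... | no  _ = inj₂ refl

fold-small : ∀ {b r} → 2 * r ≤ b → fold b r ≡ r
fold-small {b} {r} 2r≤b with 2 * r ≤? b
... | yes _    = refl
... | no  2r≰b = contradiction 2r≤b 2r≰b

2*[b∸r]<b : ∀ {b r} → r ≤ b → b < 2 * r → 2 * (b ∸ r) < b
2*[b∸r]<b {b} {r} r≤b b<2r = +-cancelʳ-< b (2 * (b ∸ r)) b
  (subst (2 * (b ∸ r) + b <_) (h+k≡b⇒2h+2k≡b+b (b ∸ r) r (m∸n+n≡m r≤b))
    (+-monoʳ-< (2 * (b ∸ r)) b<2r))

fold-bound : ∀ {b r} → r ≤ b → 2 * fold b r ≤ b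
fold-bound {b} {r} r≤b with 2 * r ≤? b
... | yes 2r≤b = 2r≤b
... | no  2r≰b = <⇒≤ (2*[b∸r]<b r≤b (≰⇒> 2r≰b))

fold-complement : ∀ {b} h k → Odd b → h + k ≡ b → fold b h ≡ fold b k
fold-complement {b} h k odd h+k≡b with 2 * h ≤? b | 2 * k ≤? b
... | yes 2h≤b | yes 2k≤b = contradiction (≤-antisym 2h≤b b≤2h) (odd⇒≢2* h odd ∘ sym)
  where
  b≤2h : b ≤ 2 * h
  b≤2h = +-cancelʳ-≤ b b (2 * h)
    (subst (_≤ 2 * h + b) (h+k≡b⇒2h+2k≡b+b h k h+k≡b) (+-monoʳ-≤ (2 * h) 2k≤b))
... | yes _ | no _ = sym (trans (cong (_∸ k) (sym h+k≡b)) (m+n∸n≡m h k))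
... | no _ | yes _ = trans (cong (_∸ h) (sym h+k≡b)) (m+n∸m≡n h k)
... | no 2h≰b | no 2k≰b =
  contradiction (+-mono-< (≰⇒> 2h≰b) (≰⇒> 2k≰b)) (<-irrefl (sym (h+k≡b⇒2h+2k≡b+b h k h+k≡b)))

fold-≡⇒≡⊎complement : ∀ {b h k} → h ≤ b → k ≤ b →
  fold b h ≡ fold b k → h ≡ k ⊎ h + k ≡ b
fold-≡⇒≡⊎complement {b} {h} {k} h≤b k≤b eq with 2 * h ≤? b | 2 * k ≤? b
... | yes _ | yes _ = inj₁ eq
... | yes _ | no  _ = inj₂ (trans (cong (_+ k) eq) (m∸n+n≡m k≤b))
... | no  _ | yes _ = inj₂ (trans (cong (_+_ h) (sym eq)) (m+[n∸m]≡n h≤b))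
... | no  _ | no  _ = inj₁ (∸-cancelˡ-≡ h≤b k≤b eq)

fold-2*-injective : ∀ {b x y} → Odd b → 2 * x ≤ b → 2 * y ≤ b →
  fold b (2 * x) ≡ fold b (2 * y) → x ≡ y
fold-2*-injective {b} {x} {y} odd 2x≤b 2y≤b eq with fold-≡⇒≡⊎complement 2x≤b 2y≤b eq
... | inj₁ 2x≡2y = *-cancelˡ-≡ x y 2 2x≡2y
... | inj₂ 2x+2y≡b = contradiction (trans (sym 2x+2y≡b) (sym (*-distribˡ-+ 2 x y))) (odd⇒≢2* (x + y) odd)

odd-fold-2* : ∀ {b} x → Odd (fold b (2 * x)) → fold b (2 * x) ≡ b ∸ 2 * x
odd-fold-2* {b} x odd with fold-cases b (2 * x)
... | inj₁ fold≡2x = contradiction fold≡2x (odd⇒≢2* x odd)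
... | inj₂ fold≡b∸2x = fold≡b∸2x

∣b-2*[b∸x]∣≡b∸2*fold : ∀ {b x} → x ≤ b → ∣ b - 2 * (b ∸ x) ∣ ≡ b ∸ 2 * fold b x
∣b-2*[b∸x]∣≡b∸2*fold {b} {x} x≤b with 2 * x ≤? b
... | no  2x≰b = m≤n⇒∣n-m∣≡n∸m (<⇒≤ (2*[b∸r]<b x≤b (≰⇒> 2x≰b)))
... | yes 2x≤b = begin
  ∣ b - 2 * y ∣         ≡⟨ cong₂ ∣_-_∣ (sym x+y≡b) (2*n≡n+n y) ⟩
  ∣ x + y - y + y ∣     ≡⟨ cong (λ z → ∣ z - y + y ∣) (+-comm x y) ⟩
  ∣ y + x - y + y ∣     ≡⟨ ∣m+n-m+o∣≡∣n-o∣ y x y ⟩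
  ∣ x - y ∣             ≡⟨ m≤n⇒∣m-n∣≡n∸m x≤y ⟩
  y ∸ x                 ≡⟨ [m+n]∸[m+o]≡n∸o x y x ⟨
  x + y ∸ (x + x)       ≡⟨ cong₂ _∸_ (sym x+y≡b) (2*n≡n+n x) ⟨
  b ∸ 2 * x             ∎
  where
  open ≡-Reasoning
  y = b ∸ x
  x+y≡b : x + y ≡ b
  x+y≡b = m+[n∸m]≡n x≤b
  x≤y : x ≤ y
  x≤y = +-cancelˡ-≤ x x y (subst (x + x ≤_) (sym x+y≡b) (subst (_≤ b) (2*n≡n+n x) 2x≤b))

[2*m]%b≡[2*[m%b]]%b : ∀ m b .{{_ : NonZero b}} → (2 * m) % b ≡ (2 * (m % b)) % b
[2*m]%b≡[2*[m%b]]%b m b = begin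
  (2 * m) % b                   ≡⟨ %-distribˡ-* 2 m b ⟩
  ((2 % b) * (m % b)) % b       ≡⟨ cong (λ z → ((2 % b) * z) % b) (m%n%n≡m%n m b) ⟨
  ((2 % b) * (m % b % b)) % b   ≡⟨ %-distribˡ-* 2 (m % b) b ⟨
  (2 * (m % b)) % b             ∎
  where open ≡-Reasoning

fold[2*fold%]≡fold[2*%] : ∀ {b r} .{{_ : NonZero b}} → Odd b → r < b →
  fold b ((2 * fold b r) % b) ≡ fold b ((2 * r) % b)
fold[2*fold%]≡fold[2*%] {b} {r} odd r<b with 2 * r ≤? b
... | yes _    = refl
... | no  2r≰b = begin
  fold b ((2 * (b ∸ r)) % b) ≡⟨ cong (fold b) (m<n⇒m%n≡m 2[b∸r]<b) ⟩
  fold b (2 * (b ∸ r))       ≡⟨ fold-complement (2 * (b ∸ r)) (2 * r ∸ b) odd complement ⟩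
  fold b (2 * r ∸ b)         ≡⟨ cong (fold b) (m<n⇒m%n≡m 2r∸b<b) ⟨
  fold b ((2 * r ∸ b) % b)   ≡⟨ cong (fold b) (m≤n⇒[n∸m]%m≡n%m b≤2r) ⟩
  fold b ((2 * r) % b)       ∎
  where
  open ≡-Reasoning
  b<2r : b < 2 * r
  b<2r = ≰⇒> 2r≰b
  b≤2r : b ≤ 2 * r
  b≤2r = <⇒≤ b<2r
  2[b∸r]<b : 2 * (b ∸ r) < b
  2[b∸r]<b = 2*[b∸r]<b (<⇒≤ r<b) b<2r
  2r∸b<b : 2 * r ∸ b < b
  2r∸b<b = m<n+o⇒m∸n<o (2 * r) b (subst (2 * r <_) (2*n≡n+n b) (*-monoʳ-< 2 r<b))
  complement : 2 * (b ∸ r) + (2 * r ∸ b) ≡ b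
  complement = +-cancelʳ-≡ b _ b (begin
    2 * (b ∸ r) + (2 * r ∸ b) + b ≡⟨ +-assoc (2 * (b ∸ r)) (2 * r ∸ b) b ⟩
    2 * (b ∸ r) + (2 * r ∸ b + b) ≡⟨ cong (_+_ (2 * (b ∸ r))) (m∸n+n≡m b≤2r) ⟩
    2 * (b ∸ r) + 2 * r           ≡⟨ h+k≡b⇒2h+2k≡b+b (b ∸ r) r (m∸n+n≡m (<⇒≤ r<b)) ⟩
    b + b                         ∎)

cSeq-bound : ∀ b a k .{{_ : NonZero b}} → 2 * cSeq b a k ≤ b
cSeq-bound b a k = subst (λ c → 2 * c ≤ b) (sym (modStar≡fold (a * 2 ^ k) b))
  (fold-bound (<⇒≤ (m%n<n (a * 2 ^ k) b)))

cSeq-zero : ∀ {b a} .{{_ : NonZero b}} → Odd b → 2 * a ≤ b → cSeq b a 0 ≡ a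
cSeq-zero {b} {a} odd 2a≤b = begin
  modStar (a * 1) b    ≡⟨ modStar≡fold (a * 1) b ⟩
  fold b ((a * 1) % b) ≡⟨ cong (λ m → fold b (m % b)) (*-identityʳ a) ⟩
  fold b (a % b)       ≡⟨ cong (fold b) (m<n⇒m%n≡m a<b) ⟩
  fold b a             ≡⟨ fold-small 2a≤b ⟩
  a                    ∎
  where
  open ≡-Reasoning
  a<b : a < b
  a<b = ≤-<-trans (m≤m+n a (a + 0)) (odd⇒2*< a odd 2a≤b)

cSeq-suc : ∀ {b} a k .{{_ : NonZero b}} → Odd b →
  cSeq b a (suc k) ≡ fold b (2 * cSeq b a k)
cSeq-suc {b} a k odd = begin
  modStar (a * 2 ^ suc k) b       ≡⟨ modStar≡fold (a * 2 ^ suc k) b ⟩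
  fold b ((a * (2 * 2 ^ k)) % b)  ≡⟨ cong (λ n → fold b (n % b)) a*[2*q]≡2*[a*q] ⟩
  fold b ((2 * m) % b)            ≡⟨ cong (fold b) ([2*m]%b≡[2*[m%b]]%b m b) ⟩
  fold b ((2 * (m % b)) % b)      ≡⟨ fold[2*fold%]≡fold[2*%] odd (m%n<n m b) ⟨
  fold b ((2 * c) % b)            ≡⟨ cong (fold b) (m<n⇒m%n≡m (odd⇒2*< c odd (fold-bound (<⇒≤ (m%n<n m b))))) ⟩
  fold b (2 * c)                  ≡⟨ cong (λ z → fold b (2 * z)) (modStar≡fold m b) ⟨
  fold b (2 * cSeq b a k)         ∎
  where
  open ≡-Reasoning
  m = a * 2 ^ k
  c = fold b (m % b)
  a*[2*q]≡2*[a*q] : a * (2 * 2 ^ k) ≡ 2 * m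
  a*[2*q]≡2*[a*q] = trans (sym (*-assoc a 2 (2 ^ k)))
    (trans (cong (_* 2 ^ k) (*-comm a 2)) (*-assoc 2 a (2 ^ k)))

mdsInput-odd : ∀ {b i a} → IsMDSInput b i a → Odd a
mdsInput-odd (_ , start , _)            = refl
mdsInput-odd (_ , step _ (odd , _) , _) = odd

mdsInput-2*≤ : ∀ {b i a} → 3 ≤ b → IsMDSInput b i a → 2 * a ≤ b
mdsInput-2*≤ 3≤b (_ , start , _)                           = ≤-trans (n≤1+n 2) 3≤b
mdsInput-2*≤ _   (_ , step _ (_ , (_ , 2a<b , _) , _) , _) = <⇒≤ 2a<b

cSeq-returns : ∀ {b a} p .{{_ : NonZero b}} → Odd b → 2 * a ≤ b →
  IsPeriod (λ j → cSeq b a (suc j)) (suc p) → cSeq b a (suc p) ≡ a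
cSeq-returns {b} {a} p odd 2a≤b (_ , periodic) = begin
  c (suc p)     ≡⟨ cong c (+-identityʳ (suc p)) ⟨
  c (suc p + 0) ≡⟨ fold-2*-injective odd (cSeq-bound b a (suc p + 0)) 2a≤b images-agree ⟩
  a             ∎
  where
  open ≡-Reasoning
  c = cSeq b a
  images-agree : fold b (2 * c (suc p + 0)) ≡ fold b (2 * a)
  images-agree = begin
    fold b (2 * c (suc p + 0)) ≡⟨ cSeq-suc a (suc p + 0) odd ⟨
    c (suc (suc p + 0))        ≡⟨ periodic 0 ⟩
    c 1                        ≡⟨ cSeq-suc a 0 odd ⟩
    fold b (2 * c 0)           ≡⟨ cong (λ z → fold b (2 * z)) (cSeq-zero {b} {a} odd 2a≤b) ⟩
    fold b (2 * a)             ∎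

schick≡b∸2*cSeq : ∀ {b a} p .{{_ : NonZero b}} → Odd b → Odd a →
  cSeq b a (suc p) ≡ a → ∀ j → schick b a j ≡ b ∸ 2 * cSeq b a (p + j)
schick≡b∸2*cSeq {b} {a} p odd-b odd-a c[1+p]≡a zero = begin
  a                  ≡⟨ c[1+p]≡a ⟨
  c (suc p)          ≡⟨ cSeq-suc a p odd-b ⟩
  fold b (2 * c p)   ≡⟨ odd-fold-2* (c p) (subst Odd a≡fold odd-a) ⟩
  b ∸ 2 * c p        ≡⟨ cong (λ k → b ∸ 2 * c k) (+-identityʳ p) ⟨
  b ∸ 2 * c (p + 0)  ∎
  where
  open ≡-Reasoning
  c = cSeq b a
  a≡fold : a ≡ fold b (2 * c p)
  a≡fold = trans (sym c[1+p]≡a) (cSeq-suc a p odd-b)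
schick≡b∸2*cSeq {b} {a} p odd-b odd-a c[1+p]≡a (suc j) = begin
  ∣ b - 2 * schick b a j ∣            ≡⟨ cong (λ q → ∣ b - 2 * q ∣) (schick≡b∸2*cSeq p odd-b odd-a c[1+p]≡a j) ⟩
  ∣ b - 2 * (b ∸ 2 * c (p + j)) ∣     ≡⟨ ∣b-2*[b∸x]∣≡b∸2*fold (cSeq-bound b a (p + j)) ⟩
  b ∸ 2 * fold b (2 * c (p + j))      ≡⟨ cong (λ z → b ∸ 2 * z) (cSeq-suc a (p + j) odd-b) ⟨
  b ∸ 2 * c (suc (p + j))             ≡⟨ cong (λ k → b ∸ 2 * c k) (+-suc p j) ⟨
  b ∸ 2 * c (p + suc j)               ∎
  where
  open ≡-Reasoning
  c = cSeq b a

proposition33 : (b : ℕ) → 3 ≤ b → b % 2 ≡ 1 →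
    (i a : ℕ) → IsMDSInput b i a →
    (P pes : ℕ) →
    IsPrimitivePeriod (λ j → cSeq b a (suc j)) P →
    IsPrimitivePeriod (schick b a) pes →
    (j : ℕ) → j ≤ pes →
    + schick b a j ≡ + b - + (2 * cSeq b a (P ∸ 1 + j))
proposition33 b@(suc _) 3≤b odd-b _ a input (suc p) _ (c-periodic , _) _ j _ = begin
  + schick b a j                 ≡⟨ cong +_ (schick≡b∸2*cSeq p odd-b (mdsInput-odd input) c-returns j) ⟩
  + (b ∸ 2 * cSeq b a (p + j))   ≡⟨ ℤ.⊖-≥ (cSeq-bound b a (p + j)) ⟨
  b ⊖ 2 * cSeq b a (p + j)       ≡⟨ ℤ.m-n≡m⊖n b (2 * cSeq b a (p + j)) ⟨
  + b - + (2 * cSeq b a (p + j)) ∎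
  where
  open ≡-Reasoning
  c-returns : cSeq b a (suc p) ≡ a
  c-returns = cSeq-returns p odd-b (mdsInput-2*≤ 3≤b input) c-periodic
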